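{- For every $n\ge1$ there exists a bijection $\psi:PM_{2n}\to PM_{2n}$ such that $\ell(\psi(\pi))=n^2-n-\ell(\pi)$ for every $\pi\in PM_{2n}$.
   Context: A perfect matching on $[2n]$ is a set partition of $[2n]$ into blocks of size $2$; $PM_{2n}$ is the set of them. A block $\{i<j\}$ is an arc $(i,j)$ with span $j-i-1$. Two arcs $(i,j),(k,l)$ cross if $i<k<j<l$; $\mathrm{cr}(\pi)$ is the number of crossing pairs of arcs. The function $\ell$ (the rank function of the Bruhat order on fixed-point-free involutions of $S_{2n}$, identified with perfect matchings) is $\ell(\pi)=\sum_{\text{arcs }\alpha}\mathrm{span}(\alpha)-\mathrm{cr}(\pi)$. -}

module Defs where

open import Data.Nat using (ℕ; zero; suc; _+_; _*_; _∸_; _<_)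
open import Data.Nat.Properties using (_<?_)
open import Data.Fin using (Fin; toℕ)
open import Data.List using (List; map; allFin)
open import Data.Nat.ListAction using (sum)
open import Data.Integer using (ℤ; +_; _-_)
open import Relation.Binary.PropositionalEquality using (_≡_; _≢_)
open import Relation.Nullary using (does)
open import Data.Bool using (if_then_else_)

-- A perfect matching on [2n] (points indexed 0,…,2n-1 by Fin (2 * n)),
-- represented as a fixed-point-free involution: each point i is paired with p i.
record PM (n : ℕ) : Set where
  constructor mkPM
  field
    pair    : Fin (2 * n) → Fin (2 * n)
    invol   : ∀ i → pair (pair i) ≡ i
    fpfree  : ∀ i → pair i ≢ i
open PM public

_≈PM_ : ∀ {n} → PM n → PM n → Set
π ≈PM σ = ∀ i → pair π i ≡ pair σ i

ΣFin : ∀ {m} → (Fin m → ℕ) → ℕ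
ΣFin {m} f = sum (map f (allFin m))

[_<_] : ℕ → ℕ → ℕ
[ a < b ] = if does (a <? b) then 1 else 0

-- Sum of spans: each arc (i, j) with i < j is counted once, from its left end i,
-- contributing span j - i - 1.
totalSpan : ∀ {n} → PM n → ℕ
totalSpan π = ΣFin λ i →
  let a = toℕ i ; b = toℕ (pair π i) in
  if does (a <? b) then b ∸ a ∸ 1 else 0

-- Number of crossing pairs: arcs (i, j), (k, l) with i < k < j < l,
-- counted via their left ends i and k.
crossings : ∀ {n} → PM n → ℕ
crossings π = ΣFin λ i → ΣFin λ k →
  let a = toℕ i ; b = toℕ (pair π i) ; c = toℕ k ; d = toℕ (pair π k) in
  [ a < c ] * [ c < b ] * [ b < d ]

ℓ : ∀ {n} → PM n → ℤ
ℓ π = + totalSpan π - + crossings π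

{-# OPTIONS --safe #-}
module Submission where

-- Call (i, k) a return of a matching p when k lies strictly inside the arc (i, p i) and p k < p i.
-- The span of the arc (i, p i) counts the points k inside it, and those with p k > p i are exactly
-- its crossings with left end i, so ℓ is the number of returns. Deleting the arc (0, j + 1) at the
-- first point deletes exactly j returns; hence, coding a matching on 2n points by the digits
-- j₁, …, jₙ (with j_k ≤ 2(n − k)) read off by repeatedly deleting the first arc, ℓ is the digit
-- sum. Replacing every digit d by its complement 2(n − k) − d is an involution on codes that turns
-- the digit sum s into (2n − 2) + (2n − 4) + ⋯ + 0 − s = n² − n − s.

open import Defs
open import Data.Nat using (ℕ; zero; suc; _+_; _*_; _∸_; _≤_; z≤n; s≤s)
import Data.Nat.Properties as ℕₚ
open import Data.Nat.Properties using (_<?_)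
open import Data.Nat.Tactic.RingSolver using (solve-∀)
import Data.Nat.ListAction as List
open import Data.Fin using (Fin; zero; suc; toℕ; punchIn; punchOut; opposite; _≟_)
import Data.Fin.Properties as Finₚ
open import Data.List using (tabulate)
open import Data.List.Properties using (map-tabulate)
open import Algebra.Properties.CommutativeMonoid.Sum ℕₚ.+-0-commutativeMonoid
  using (sum; sum-cong-≗; sum-remove; ∑-distrib-+; sum-replicate-zero)
open import Data.Integer using (+_; _-_)
import Data.Integer.Properties as ℤₚ
open import Data.Empty using (⊥; ⊥-elim)
open import Data.Unit using (⊤; tt)
open import Data.Sum using (_⊎_; inj₁; inj₂)
open import Data.Product using (Σ; _×_; _,_)
open import Function using (id; _∘_)
open import Relation.Nullary using (yes; no; does)
open import Data.Bool using (if_then_else_)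
open import Relation.Binary.PropositionalEquality

ΣFin≡sum : ∀ {m} (f : Fin m → ℕ) → ΣFin f ≡ sum f
ΣFin≡sum f = trans (cong List.sum (map-tabulate id f)) (sum-tabulate f)
  where
  sum-tabulate : ∀ {m} (g : Fin m → ℕ) → List.sum (tabulate g) ≡ sum g
  sum-tabulate {zero}  g = refl
  sum-tabulate {suc m} g = cong (λ s → g zero + s) (sum-tabulate (g ∘ suc))

sum-remove-0-suc : ∀ {m} (j : Fin (suc m)) (f : Fin (suc (suc m)) → ℕ) →
                   sum f ≡ f zero + (f (suc j) + sum (f ∘ suc ∘ punchIn j))
sum-remove-0-suc j f = cong (λ s → f zero + s) (sum-remove {i = j} (f ∘ suc))

+[m∸n]≡+m-+n : ∀ {m n} → n ≤ m → + (m ∸ n) ≡ + m - + n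
+[m∸n]≡+m-+n {m} {n} n≤m = sym (trans (ℤₚ.[+m]-[+n]≡m⊖n m n) (ℤₚ.⊖-≥ n≤m))

⟦_<_⟧ : ∀ {m n} → Fin m → Fin n → ℕ
⟦ a < b ⟧ = [ toℕ a < toℕ b ]

[<]-irrefl : ∀ a → [ a < a ] ≡ 0
[<]-irrefl zero    = refl
[<]-irrefl (suc a) = [<]-irrefl a

[<]-connex : ∀ a b → a ≢ b → [ a < b ] + [ b < a ] ≡ 1
[<]-connex zero    zero    a≢b = ⊥-elim (a≢b refl)
[<]-connex zero    (suc b) _   = refl
[<]-connex (suc a) zero    _   = refl
[<]-connex (suc a) (suc b) a≢b = [<]-connex a b (a≢b ∘ cong suc)

[<]-0∨1 : ∀ a b → [ a < b ] ≡ 0 ⊎ [ a < b ] ≡ 1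
[<]-0∨1 zero    zero    = inj₁ refl
[<]-0∨1 zero    (suc b) = inj₂ refl
[<]-0∨1 (suc a) zero    = inj₁ refl
[<]-0∨1 (suc a) (suc b) = [<]-0∨1 a b

count-below : ∀ M b → b ≤ M → sum {M} (λ k → [ toℕ k < b ]) ≡ b
count-below zero    zero    _         = refl
count-below (suc M) zero    _         = sum-replicate-zero M
count-below (suc M) (suc b) (s≤s b≤M) = cong suc (count-below M b b≤M)

count-between : ∀ M a b → b ≤ M → sum {M} (λ k → [ a < toℕ k ] * [ toℕ k < b ]) ≡ b ∸ a ∸ 1
count-between zero    a       zero    _         = cong (_∸ 1) (sym (ℕₚ.0∸n≡0 a))
count-between (suc M) zero    zero    _         = sum-replicate-zero M
count-between (suc M) zero    (suc b) (s≤s b≤M) =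
  trans (sum-cong-≗ {M} (λ k → ℕₚ.*-identityˡ [ toℕ k < b ])) (count-below M b b≤M)
count-between (suc M) (suc a) zero    _         =
  trans (sum-cong-≗ {M} (λ k → ℕₚ.*-zeroʳ [ a < toℕ k ])) (sum-replicate-zero M)
count-between (suc M) (suc a) (suc b) (s≤s b≤M) = count-between M a b b≤M

punchIn-⟦<⟧ : ∀ {m} (j : Fin (suc m)) (a b : Fin m) → ⟦ punchIn j a < punchIn j b ⟧ ≡ ⟦ a < b ⟧
punchIn-⟦<⟧ zero    a       b       = refl
punchIn-⟦<⟧ (suc j) zero    zero    = refl
punchIn-⟦<⟧ (suc j) zero    (suc b) = refl
punchIn-⟦<⟧ (suc j) (suc a) zero    = refl
punchIn-⟦<⟧ (suc j) (suc a) (suc b) = punchIn-⟦<⟧ j a b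

punchIn-⟦<pivot⟧ : ∀ {m} (j : Fin (suc m)) (a : Fin m) → ⟦ punchIn j a < j ⟧ ≡ ⟦ a < j ⟧
punchIn-⟦<pivot⟧ zero    a       = refl
punchIn-⟦<pivot⟧ (suc j) zero    = refl
punchIn-⟦<pivot⟧ (suc j) (suc a) = punchIn-⟦<pivot⟧ j a

punchIn-⟦pivot<⟧ : ∀ {m} (j : Fin (suc m)) (a : Fin m) → ⟦ j < punchIn j a ⟧ + ⟦ a < j ⟧ ≡ 1
punchIn-⟦pivot<⟧ zero    a       = refl
punchIn-⟦pivot<⟧ (suc j) zero    = refl
punchIn-⟦pivot<⟧ (suc j) (suc a) = punchIn-⟦pivot<⟧ j a

record Matching (m : ℕ) : Set where
  constructor mkMatching
  field
    partner            : Fin m → Fin m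
    partner-involutive : ∀ i → partner (partner i) ≡ i
    partner-≢          : ∀ i → partner i ≢ i
open Matching public

partner-injective : ∀ {m} (M : Matching m) {i k} → partner M i ≡ partner M k → i ≡ k
partner-injective M {i} {k} eq =
  trans (sym (partner-involutive M i)) (trans (cong (partner M) eq) (partner-involutive M k))

toMatching : ∀ {n} → PM n → Matching (2 * n)
toMatching π = mkMatching (pair π) (invol π) (fpfree π)

fromMatching : ∀ {n} → Matching (2 * n) → PM n
fromMatching M = mkPM (partner M) (partner-involutive M) (partner-≢ M)

underReturn : ∀ {m} → (Fin m → Fin m) → Fin m → Fin m → ℕ
underReturn p i k = ⟦ i < k ⟧ * ⟦ k < p i ⟧ * ⟦ p k < p i ⟧

underReturns : ∀ {m} → (Fin m → Fin m) → ℕ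
underReturns p = sum λ i → sum λ k → underReturn p i k

underReturns-cong : ∀ {m} {p q : Fin m → Fin m} → p ≗ q → underReturns p ≡ underReturns q
underReturns-cong p≗q = sum-cong-≗ λ i → sum-cong-≗ λ k →
  cong₂ (λ u v → ⟦ i < k ⟧ * ⟦ k < u ⟧ * ⟦ v < u ⟧) (p≗q i) (p≗q k)

span-guard-redundant : ∀ a b → (if does (a <? b) then b ∸ a ∸ 1 else 0) ≡ b ∸ a ∸ 1
span-guard-redundant zero    zero    = refl
span-guard-redundant zero    (suc b) = refl
span-guard-redundant (suc a) zero    = refl
span-guard-redundant (suc a) (suc b) = span-guard-redundant a b

under-split : ∀ a c b d → ([ a < c ] ≡ 1 → b ≢ d) →
              [ a < c ] * [ c < b ] ≡ [ a < c ] * [ c < b ] * [ b < d ] + [ a < c ] * [ c < b ] * [ d < b ]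
under-split a c b d a<c⇒b≢d with [<]-0∨1 a c
... | inj₁ a≮c rewrite a≮c = refl
... | inj₂ a<c = begin
  x                               ≡⟨ ℕₚ.*-identityʳ x ⟨
  x * 1                           ≡⟨ cong (x *_) ([<]-connex b d (a<c⇒b≢d a<c)) ⟨
  x * ([ b < d ] + [ d < b ])     ≡⟨ ℕₚ.*-distribˡ-+ x [ b < d ] [ d < b ] ⟩
  x * [ b < d ] + x * [ d < b ]   ∎
  where
  open ≡-Reasoning
  x = [ a < c ] * [ c < b ]

totalSpan≡crossings+underReturns : ∀ {n} (π : PM n) → totalSpan π ≡ crossings π + underReturns (pair π)
totalSpan≡crossings+underReturns {n} π = begin
  totalSpan π
    ≡⟨ trans (ΣFin≡sum {2 * n} _) (sum-cong-≗ {2 * n} λ i → span-guard-redundant (toℕ i) (toℕ (p i))) ⟩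
  sum (λ i → toℕ (p i) ∸ toℕ i ∸ 1)
    ≡⟨ sum-cong-≗ {2 * n} (λ i → count-between (2 * n) (toℕ i) (toℕ (p i)) (ℕₚ.<⇒≤ (Finₚ.toℕ<n (p i)))) ⟨
  sum (λ i → sum {2 * n} λ k → ⟦ i < k ⟧ * ⟦ k < p i ⟧)
    ≡⟨ sum-cong-≗ {2 * n} (λ i → sum-cong-≗ {2 * n} λ k → under-split (toℕ i) (toℕ k) (toℕ (p i)) (toℕ (p k)) (i<k⇒pi≢pk i k)) ⟩
  sum (λ i → sum λ k → crossing i k + underReturn p i k)
    ≡⟨ sum-cong-≗ {2 * n} (λ i → ∑-distrib-+ {2 * n} (crossing i) (underReturn p i)) ⟩
  sum (λ i → sum (crossing i) + sum (underReturn p i))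
    ≡⟨ ∑-distrib-+ (sum ∘ crossing) (sum ∘ underReturn p) ⟩
  sum (sum ∘ crossing) + underReturns p
    ≡⟨ cong (_+ underReturns p) (trans (ΣFin≡sum {2 * n} _) (sum-cong-≗ {2 * n} (ΣFin≡sum {2 * n} ∘ crossing))) ⟨
  crossings π + underReturns p
    ∎
  where
  open ≡-Reasoning
  p = pair π
  crossing : Fin (2 * n) → Fin (2 * n) → ℕ
  crossing i k = ⟦ i < k ⟧ * ⟦ k < p i ⟧ * ⟦ p i < p k ⟧
  i<k⇒pi≢pk : ∀ i k → ⟦ i < k ⟧ ≡ 1 → toℕ (p i) ≢ toℕ (p k)
  i<k⇒pi≢pk i k i<k pi≡pk with partner-injective (toMatching π) (Finₚ.toℕ-injective pi≡pk)
  ... | refl = ℕₚ.0≢1+n (trans (sym ([<]-irrefl (toℕ i))) i<k)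

ℓ≡underReturns : ∀ {n} (π : PM n) → ℓ π ≡ + underReturns (pair π)
ℓ≡underReturns π = begin
  + totalSpan π - + crossings π       ≡⟨ cong (λ t → + t - + crossings π) (totalSpan≡crossings+underReturns π) ⟩
  + (c + u) - + c                     ≡⟨ +[m∸n]≡+m-+n (ℕₚ.m≤m+n c u) ⟨
  + (c + u ∸ c)                       ≡⟨ cong +_ (ℕₚ.m+n∸m≡n c u) ⟩
  + u                                 ∎
  where
  open ≡-Reasoning
  c = crossings π
  u = underReturns (pair π)

noMatching₁ : Matching 1 → ⊥
noMatching₁ M with partner M zero | partner-≢ M zero
... | zero | 0≢0 = 0≢0 refl

shift : ∀ {m} → Fin (suc m) → Fin m → Fin (suc (suc m))
shift j x = suc (punchIn j x)

shift-injective : ∀ {m} (j : Fin (suc m)) {x y} → shift j x ≡ shift j y → x ≡ y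
shift-injective j = Finₚ.punchIn-injective j _ _ ∘ Finₚ.suc-injective

pivot-or-punchIn : ∀ {m} (j y : Fin (suc m)) → y ≡ j ⊎ Σ (Fin m) λ x → y ≡ punchIn j x
pivot-or-punchIn j y with y ≟ j
... | yes y≡j = inj₁ y≡j
... | no  y≢j = inj₂ (punchOut (y≢j ∘ sym) , sym (Finₚ.punchIn-punchOut _))

-- The arc (0, j + 1) added to q, whose points are relabelled by shift j.
consPartner : ∀ {m} → Fin (suc m) → (Fin m → Fin m) → Fin (suc (suc m)) → Fin (suc (suc m))
consPartner j q zero    = suc j
consPartner j q (suc y) with y ≟ j
... | yes _  = zero
... | no y≢j = shift j (q (punchOut (y≢j ∘ sym)))

consPartner-pivot : ∀ {m} (j : Fin (suc m)) q → consPartner j q (suc j) ≡ zero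
consPartner-pivot j q with j ≟ j
... | yes _ = refl
... | no j≢j = ⊥-elim (j≢j refl)

consPartner-shift : ∀ {m} (j : Fin (suc m)) q x → consPartner j q (shift j x) ≡ shift j (q x)
consPartner-shift j q x with punchIn j x ≟ j
... | yes eq = ⊥-elim (Finₚ.punchInᵢ≢i j x eq)
... | no _   = cong (shift j ∘ q) (trans (Finₚ.punchOut-cong j refl) (Finₚ.punchOut-punchIn j))

consPartner-unique : ∀ {m} (j : Fin (suc m)) q (P : Fin (suc (suc m)) → Fin (suc (suc m))) →
                     P zero ≡ suc j → P (suc j) ≡ zero → (∀ x → P (shift j x) ≡ shift j (q x)) →
                     consPartner j q ≗ P
consPartner-unique j q P P0 Pj Pshift zero = sym P0
consPartner-unique j q P P0 Pj Pshift (suc y) with pivot-or-punchIn j y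
... | inj₁ refl       = trans (consPartner-pivot j q) (sym Pj)
... | inj₂ (x , refl) = trans (consPartner-shift j q x) (sym (Pshift x))

consMatching : ∀ {m} → Fin (suc m) → Matching m → Matching (suc (suc m))
consMatching j Q = mkMatching P involutive ≢
  where
  P = consPartner j (partner Q)
  involutive : ∀ i → P (P i) ≡ i
  involutive zero = consPartner-pivot j (partner Q)
  involutive (suc y) with pivot-or-punchIn j y
  ... | inj₁ refl = cong P (consPartner-pivot j (partner Q))
  ... | inj₂ (x , refl) = begin
    P (P (shift j x))             ≡⟨ cong P (consPartner-shift j (partner Q) x) ⟩
    P (shift j (partner Q x))     ≡⟨ consPartner-shift j (partner Q) (partner Q x) ⟩
    shift j (partner Q (partner Q x)) ≡⟨ cong (shift j) (partner-involutive Q x) ⟩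
    shift j x                     ∎
    where open ≡-Reasoning
  ≢ : ∀ i → P i ≢ i
  ≢ zero ()
  ≢ (suc y) with pivot-or-punchIn j y
  ... | inj₁ refl = Finₚ.0≢1+n ∘ trans (sym (consPartner-pivot j (partner Q)))
  ... | inj₂ (x , refl) =
    partner-≢ Q x ∘ shift-injective j ∘ trans (sym (consPartner-shift j (partner Q) x))

module Uncons {m} (M : Matching (suc (suc m))) where
  private
    P = partner M

  pivot : Fin (suc m)
  pivot = punchOut (partner-≢ M zero ∘ sym)

  partner-zero : P zero ≡ suc pivot
  partner-zero = sym (Finₚ.punchIn-punchOut (partner-≢ M zero ∘ sym))

  partner-pivot : P (suc pivot) ≡ zero
  partner-pivot = trans (cong P (sym partner-zero)) (partner-involutive M zero)

  private
    image : Fin m → Fin (suc (suc m))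
    image x = P (shift pivot x)

    zero≢image : ∀ x → zero ≢ image x
    zero≢image x eq = Finₚ.punchInᵢ≢i pivot x (sym (Finₚ.suc-injective (begin
      suc pivot              ≡⟨ partner-zero ⟨
      P zero                 ≡⟨ cong P eq ⟩
      P (image x)            ≡⟨ partner-involutive M _ ⟩
      shift pivot x          ∎)))
      where open ≡-Reasoning

    pivot≢image : ∀ x → pivot ≢ punchOut (zero≢image x)
    pivot≢image x eq = Finₚ.0≢1+n (begin
      zero                   ≡⟨ partner-pivot ⟨
      P (suc pivot)          ≡⟨ cong P (trans (cong suc eq) (Finₚ.punchIn-punchOut (zero≢image x))) ⟩
      P (image x)            ≡⟨ partner-involutive M _ ⟩
      shift pivot x          ∎)
      where open ≡-Reasoning

  restPartner : Fin m → Fin m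
  restPartner x = punchOut (pivot≢image x)

  restPartner-shift : ∀ x → shift pivot (restPartner x) ≡ P (shift pivot x)
  restPartner-shift x =
    trans (cong suc (Finₚ.punchIn-punchOut (pivot≢image x))) (Finₚ.punchIn-punchOut (zero≢image x))

  rest : Matching m
  rest = mkMatching restPartner involutive ≢
    where
    involutive : ∀ x → restPartner (restPartner x) ≡ x
    involutive x = shift-injective pivot (begin
      shift pivot (restPartner (restPartner x))  ≡⟨ restPartner-shift _ ⟩
      P (shift pivot (restPartner x))            ≡⟨ cong P (restPartner-shift x) ⟩
      P (P (shift pivot x))                      ≡⟨ partner-involutive M _ ⟩
      shift pivot x                              ∎)
      where open ≡-Reasoning
    ≢ : ∀ x → restPartner x ≢ x
    ≢ x eq = partner-≢ M (shift pivot x) (trans (sym (restPartner-shift x)) (cong (shift pivot) eq))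

Code : ℕ → Set
Code zero          = ⊤
Code (suc zero)    = ⊥
Code (suc (suc m)) = Fin (suc m) × Code m

decode : ∀ m → Code m → Matching m
decode zero          _       = mkMatching (λ ()) (λ ()) (λ ())
decode (suc (suc m)) (j , c) = consMatching j (decode m c)

encode : ∀ m → Matching m → Code m
encode zero          _ = tt
encode (suc zero)    M = noMatching₁ M
encode (suc (suc m)) M = Uncons.pivot M , encode m (Uncons.rest M)

encode-cong : ∀ m (M N : Matching m) → partner M ≗ partner N → encode m M ≡ encode m N
encode-cong zero          M N _   = refl
encode-cong (suc zero)    M N _   = ⊥-elim (noMatching₁ M)
encode-cong (suc (suc m)) M N M≗N =
  cong₂ _,_ pivot≡ (encode-cong m (Uncons.rest M) (Uncons.rest N) rest≗)
  where
  open ≡-Reasoning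
  pivot≡ : Uncons.pivot M ≡ Uncons.pivot N
  pivot≡ = Finₚ.punchOut-cong zero (M≗N zero)
  rest≗ : partner (Uncons.rest M) ≗ partner (Uncons.rest N)
  rest≗ x = shift-injective (Uncons.pivot M) (begin
    shift (Uncons.pivot M) (Uncons.restPartner M x)  ≡⟨ Uncons.restPartner-shift M x ⟩
    partner M (shift (Uncons.pivot M) x)             ≡⟨ M≗N _ ⟩
    partner N (shift (Uncons.pivot M) x)             ≡⟨ cong (λ j → partner N (shift j x)) pivot≡ ⟩
    partner N (shift (Uncons.pivot N) x)             ≡⟨ Uncons.restPartner-shift N x ⟨
    shift (Uncons.pivot N) (Uncons.restPartner N x)  ≡⟨ cong (λ j → shift j (Uncons.restPartner N x)) pivot≡ ⟨
    shift (Uncons.pivot M) (Uncons.restPartner N x)  ∎)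

encode-decode : ∀ m (c : Code m) → encode m (decode m c) ≡ c
encode-decode zero          tt      = refl
encode-decode (suc (suc m)) (j , c) = cong (j ,_) (begin
  encode m (Uncons.rest M)  ≡⟨ encode-cong m (Uncons.rest M) (decode m c) rest≗ ⟩
  encode m (decode m c)     ≡⟨ encode-decode m c ⟩
  c                         ∎)
  where
  open ≡-Reasoning
  M = consMatching j (decode m c)
  rest≗ : partner (Uncons.rest M) ≗ partner (decode m c)
  rest≗ x = shift-injective j
    (trans (Uncons.restPartner-shift M x) (consPartner-shift j (partner (decode m c)) x))

decode-encode : ∀ m (M : Matching m) → partner (decode m (encode m M)) ≗ partner M
decode-encode zero          M ()
decode-encode (suc zero)    M = ⊥-elim (noMatching₁ M)
decode-encode (suc (suc m)) M =
  consPartner-unique pivot q (partner M) partner-zero partner-pivot λ x → begin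
    partner M (shift pivot x)    ≡⟨ restPartner-shift x ⟨
    shift pivot (restPartner x)  ≡⟨ cong (shift pivot) (decode-encode m rest x) ⟨
    shift pivot (q x)            ∎
  where
  open ≡-Reasoning
  open Uncons M
  q = partner (decode m (encode m rest))

module _ {m} (j : Fin (suc m)) (q : Fin m → Fin m) where
  private
    P = consPartner j q

  underReturns-firstArc : sum (underReturn P zero) ≡ sum λ w → ⟦ w < j ⟧ * ⟦ q w < j ⟧
  underReturns-firstArc = begin
    sum (underReturn P zero)
      ≡⟨ sum-remove-0-suc j (underReturn P zero) ⟩
    underReturn P zero (suc j) + sum (λ w → underReturn P zero (shift j w))
      ≡⟨ cong (λ t → 1 * t * ⟦ P (suc j) < suc j ⟧ + sum (λ w → underReturn P zero (shift j w))) ([<]-irrefl (toℕ j)) ⟩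
    sum (λ w → underReturn P zero (shift j w))
      ≡⟨ sum-cong-≗ entry ⟩
    sum (λ w → ⟦ w < j ⟧ * ⟦ q w < j ⟧)
      ∎
    where
    open ≡-Reasoning
    entry : ∀ w → underReturn P zero (shift j w) ≡ ⟦ w < j ⟧ * ⟦ q w < j ⟧
    entry w = begin
      1 * ⟦ punchIn j w < j ⟧ * ⟦ P (shift j w) < suc j ⟧
        ≡⟨ cong (λ k → 1 * ⟦ punchIn j w < j ⟧ * ⟦ k < suc j ⟧) (consPartner-shift j q w) ⟩
      1 * ⟦ punchIn j w < j ⟧ * ⟦ punchIn j (q w) < j ⟧
        ≡⟨ cong₂ (λ u v → 1 * u * v) (punchIn-⟦<pivot⟧ j w) (punchIn-⟦<pivot⟧ j (q w)) ⟩
      1 * ⟦ w < j ⟧ * ⟦ q w < j ⟧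
        ≡⟨ cong (_* ⟦ q w < j ⟧) (ℕₚ.*-identityˡ ⟦ w < j ⟧) ⟩
      ⟦ w < j ⟧ * ⟦ q w < j ⟧
        ∎

  underReturns-pivot : sum (underReturn P (suc j)) ≡ 0
  underReturns-pivot = trans (sum-cong-≗ entry) (sum-replicate-zero (suc (suc m)))
    where
    entry : ∀ k → underReturn P (suc j) k ≡ 0
    entry k rewrite consPartner-pivot j q = ℕₚ.*-zeroʳ (⟦ suc j < k ⟧ * 0)

  underReturns-shift : ∀ x → sum (underReturn P (shift j x)) ≡
                       ⟦ x < j ⟧ * ⟦ j < punchIn j (q x) ⟧ + sum (underReturn q x)
  underReturns-shift x = trans (sum-remove-0-suc j (underReturn P (shift j x)))
                               (cong₂ _+_ pivot-entry (sum-cong-≗ shift-entry))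
    where
    open ≡-Reasoning
    pivot-entry : underReturn P (shift j x) (suc j) ≡ ⟦ x < j ⟧ * ⟦ j < punchIn j (q x) ⟧
    pivot-entry = begin
      ⟦ punchIn j x < j ⟧ * ⟦ suc j < P (shift j x) ⟧ * ⟦ P (suc j) < P (shift j x) ⟧
        ≡⟨ cong₂ (λ u v → ⟦ punchIn j x < j ⟧ * ⟦ suc j < u ⟧ * ⟦ v < u ⟧)
                 (consPartner-shift j q x) (consPartner-pivot j q) ⟩
      ⟦ punchIn j x < j ⟧ * ⟦ j < punchIn j (q x) ⟧ * 1
        ≡⟨ ℕₚ.*-identityʳ _ ⟩
      ⟦ punchIn j x < j ⟧ * ⟦ j < punchIn j (q x) ⟧
        ≡⟨ cong (_* ⟦ j < punchIn j (q x) ⟧) (punchIn-⟦<pivot⟧ j x) ⟩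
      ⟦ x < j ⟧ * ⟦ j < punchIn j (q x) ⟧
        ∎
    shift-entry : ∀ w → underReturn P (shift j x) (shift j w) ≡ underReturn q x w
    shift-entry w = begin
      underReturn P (shift j x) (shift j w)
        ≡⟨ cong₂ (λ u v → ⟦ shift j x < shift j w ⟧ * ⟦ shift j w < u ⟧ * ⟦ v < u ⟧)
                 (consPartner-shift j q x) (consPartner-shift j q w) ⟩
      ⟦ punchIn j x < punchIn j w ⟧ * ⟦ punchIn j w < punchIn j (q x) ⟧ * ⟦ punchIn j (q w) < punchIn j (q x) ⟧
        ≡⟨ cong₂ _*_ (cong₂ _*_ (punchIn-⟦<⟧ j x w) (punchIn-⟦<⟧ j w (q x))) (punchIn-⟦<⟧ j (q w) (q x)) ⟩
      underReturn q x w
        ∎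

  -- Each of the j points under the first arc gives one new return: under the first arc if its
  -- partner lies left of j + 1, and otherwise the point j + 1 returns under its arc.
  underReturns-consPartner : underReturns P ≡ toℕ j + underReturns q
  underReturns-consPartner = begin
    underReturns P
      ≡⟨ sum-remove-0-suc j (sum ∘ underReturn P) ⟩
    sum (underReturn P zero) + (sum (underReturn P (suc j)) + sum (λ x → sum (underReturn P (shift j x))))
      ≡⟨ cong₂ _+_ underReturns-firstArc (cong₂ _+_ underReturns-pivot (sum-cong-≗ underReturns-shift)) ⟩
    sum underFirst + sum (λ x → overPivot x + sum (underReturn q x))
      ≡⟨ cong (λ t → sum underFirst + t) (∑-distrib-+ overPivot (sum ∘ underReturn q)) ⟩
    sum underFirst + (sum overPivot + underReturns q)
      ≡⟨ ℕₚ.+-assoc (sum underFirst) (sum overPivot) (underReturns q) ⟨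
    sum underFirst + sum overPivot + underReturns q
      ≡⟨ cong (_+ underReturns q) (trans (sym (∑-distrib-+ underFirst overPivot)) (sum-cong-≗ below-pivot)) ⟩
    sum {m} (λ x → ⟦ x < j ⟧) + underReturns q
      ≡⟨ cong (_+ underReturns q) (count-below m (toℕ j) (ℕₚ.≤-pred (Finₚ.toℕ<n j))) ⟩
    toℕ j + underReturns q
      ∎
    where
    open ≡-Reasoning
    underFirst overPivot : Fin m → ℕ
    underFirst x = ⟦ x < j ⟧ * ⟦ q x < j ⟧
    overPivot x = ⟦ x < j ⟧ * ⟦ j < punchIn j (q x) ⟧
    below-pivot : ∀ x → underFirst x + overPivot x ≡ ⟦ x < j ⟧
    below-pivot x = begin
      ⟦ x < j ⟧ * ⟦ q x < j ⟧ + ⟦ x < j ⟧ * ⟦ j < punchIn j (q x) ⟧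
        ≡⟨ ℕₚ.*-distribˡ-+ ⟦ x < j ⟧ _ _ ⟨
      ⟦ x < j ⟧ * (⟦ q x < j ⟧ + ⟦ j < punchIn j (q x) ⟧)
        ≡⟨ cong (⟦ x < j ⟧ *_) (trans (ℕₚ.+-comm ⟦ q x < j ⟧ _) (punchIn-⟦pivot<⟧ j (q x))) ⟩
      ⟦ x < j ⟧ * 1
        ≡⟨ ℕₚ.*-identityʳ ⟦ x < j ⟧ ⟩
      ⟦ x < j ⟧
        ∎

complement : ∀ m → Code m → Code m
complement zero          c       = c
complement (suc zero)    ()
complement (suc (suc m)) (j , c) = opposite j , complement m c

complement-involutive : ∀ m (c : Code m) → complement m (complement m c) ≡ c
complement-involutive zero          _       = refl
complement-involutive (suc zero)    ()
complement-involutive (suc (suc m)) (j , c) = cong₂ _,_ (Finₚ.opposite-involutive j) (complement-involutive m c)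

digitSum : ∀ m → Code m → ℕ
digitSum zero          _       = 0
digitSum (suc zero)    ()
digitSum (suc (suc m)) (j , c) = toℕ j + digitSum m c

maxDigitSum : ℕ → ℕ
maxDigitSum zero          = 0
maxDigitSum (suc zero)    = 0
maxDigitSum (suc (suc m)) = m + maxDigitSum m

digitSum≤maxDigitSum : ∀ m (c : Code m) → digitSum m c ≤ maxDigitSum m
digitSum≤maxDigitSum zero          _       = z≤n
digitSum≤maxDigitSum (suc zero)    ()
digitSum≤maxDigitSum (suc (suc m)) (j , c) =
  ℕₚ.+-mono-≤ (ℕₚ.≤-pred (Finₚ.toℕ<n j)) (digitSum≤maxDigitSum m c)

digitSum-complement : ∀ m (c : Code m) → digitSum m (complement m c) ≡ maxDigitSum m ∸ digitSum m c
digitSum-complement zero          _       = refl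
digitSum-complement (suc zero)    ()
digitSum-complement (suc (suc m)) (j , c) = begin
  toℕ (opposite j) + digitSum m (complement m c)    ≡⟨ cong₂ _+_ (Finₚ.opposite-prop j) (digitSum-complement m c) ⟩
  (m ∸ toℕ j) + (maxDigitSum m ∸ digitSum m c)       ≡⟨ ℕₚ.+-∸-assoc (m ∸ toℕ j) (digitSum≤maxDigitSum m c) ⟨
  (m ∸ toℕ j) + maxDigitSum m ∸ digitSum m c         ≡⟨ cong (_∸ digitSum m c) (ℕₚ.+-∸-comm (maxDigitSum m) j≤m) ⟨
  m + maxDigitSum m ∸ toℕ j ∸ digitSum m c           ≡⟨ ℕₚ.∸-+-assoc (m + maxDigitSum m) (toℕ j) (digitSum m c) ⟩
  m + maxDigitSum m ∸ (toℕ j + digitSum m c)         ∎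
  where
  open ≡-Reasoning
  j≤m : toℕ j ≤ m
  j≤m = ℕₚ.≤-pred (Finₚ.toℕ<n j)

maxDigitSum-even+n : ∀ n → maxDigitSum (2 * n) + n ≡ n * n
maxDigitSum-even+n zero    = refl
maxDigitSum-even+n (suc n) = begin
  maxDigitSum (2 * suc n) + suc n         ≡⟨ cong (λ t → maxDigitSum t + suc n) (ℕₚ.*-suc 2 n) ⟩
  2 * n + maxDigitSum (2 * n) + suc n     ≡⟨ regroup (2 * n) (maxDigitSum (2 * n)) n ⟩
  maxDigitSum (2 * n) + n + suc (2 * n)   ≡⟨ cong (_+ suc (2 * n)) (maxDigitSum-even+n n) ⟩
  n * n + suc (2 * n)                     ≡⟨ square-suc n ⟩
  suc n * suc n                           ∎
  where
  open ≡-Reasoning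
  regroup : ∀ a s n → a + s + suc n ≡ s + n + suc a
  regroup = solve-∀
  square-suc : ∀ n → n * n + suc (2 * n) ≡ suc n * suc n
  square-suc = solve-∀

maxDigitSum-even : ∀ n → maxDigitSum (2 * n) ≡ n * n ∸ n
maxDigitSum-even n = trans (sym (ℕₚ.m+n∸n≡m (maxDigitSum (2 * n)) n)) (cong (_∸ n) (maxDigitSum-even+n n))

underReturns-decode : ∀ m (c : Code m) → underReturns (partner (decode m c)) ≡ digitSum m c
underReturns-decode zero          _       = refl
underReturns-decode (suc zero)    ()
underReturns-decode (suc (suc m)) (j , c) =
  trans (underReturns-consPartner j (partner (decode m c))) (cong (λ s → toℕ j + s) (underReturns-decode m c))

codeOf : ∀ {n} → PM n → Code (2 * n)
codeOf {n} π = encode (2 * n) (toMatching π)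

reflect : ∀ {n} → PM n → PM n
reflect {n} π = fromMatching (decode (2 * n) (complement (2 * n) (codeOf π)))

ℓ≡digitSum : ∀ {n} (π : PM n) → ℓ π ≡ + digitSum (2 * n) (codeOf π)
ℓ≡digitSum {n} π = begin
  ℓ π                                                   ≡⟨ ℓ≡underReturns π ⟩
  + underReturns (pair π)                               ≡⟨ cong +_ (underReturns-cong (decode-encode (2 * n) (toMatching π))) ⟨
  + underReturns (partner (decode (2 * n) (codeOf π)))  ≡⟨ cong +_ (underReturns-decode (2 * n) (codeOf π)) ⟩
  + digitSum (2 * n) (codeOf π)                         ∎
  where open ≡-Reasoning

reflect-cong : ∀ {n} (π σ : PM n) → π ≈PM σ → reflect π ≈PM reflect σ
reflect-cong {n} π σ π≈σ i =
  cong (λ c → partner (decode (2 * n) (complement (2 * n) c)) i) (encode-cong (2 * n) _ _ π≈σ)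

reflect-involutive : ∀ {n} (π : PM n) → reflect (reflect π) ≈PM π
reflect-involutive {n} π i = begin
  partner (decode N (complement N (encode N (decode N (complement N c))))) i
    ≡⟨ cong (λ c′ → partner (decode N (complement N c′)) i) (encode-decode N (complement N c)) ⟩
  partner (decode N (complement N (complement N c))) i
    ≡⟨ cong (λ c′ → partner (decode N c′) i) (complement-involutive N c) ⟩
  partner (decode N c) i
    ≡⟨ decode-encode N (toMatching π) i ⟩
  pair π i
    ∎
  where
  open ≡-Reasoning
  N = 2 * n
  c = codeOf π

ℓ-reflect : ∀ {n} (π : PM n) → ℓ (reflect π) ≡ + (n * n ∸ n) - ℓ π
ℓ-reflect {n} π = begin
  ℓ (reflect π)                          ≡⟨ ℓ≡digitSum (reflect π) ⟩
  + digitSum N (codeOf (reflect π))      ≡⟨ cong (+_ ∘ digitSum N) (encode-decode N (complement N c)) ⟩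
  + digitSum N (complement N c)          ≡⟨ cong +_ (digitSum-complement N c) ⟩
  + (maxDigitSum N ∸ digitSum N c)       ≡⟨ +[m∸n]≡+m-+n (digitSum≤maxDigitSum N c) ⟩
  + maxDigitSum N - + digitSum N c       ≡⟨ cong₂ (λ s t → + s - t) (maxDigitSum-even n) (sym (ℓ≡digitSum π)) ⟩
  + (n * n ∸ n) - ℓ π                    ∎
  where
  open ≡-Reasoning
  N = 2 * n
  c = codeOf π

mainTheorem6 : (n : ℕ) → 1 ≤ n →
    Σ (PM n → PM n) λ ψ → Σ (PM n → PM n) λ φ →
      ((∀ π σ → π ≈PM σ → ψ π ≈PM ψ σ) ×
       (∀ π σ → π ≈PM σ → φ π ≈PM φ σ) ×
       (∀ π → φ (ψ π) ≈PM π) ×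
       (∀ π → ψ (φ π) ≈PM π) ×
       (∀ π → ℓ (ψ π) ≡ + (n * n ∸ n) - ℓ π))
mainTheorem6 n _ =
  reflect , reflect , reflect-cong , reflect-cong , reflect-involutive , reflect-involutive , ℓ-reflect
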